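{- Let $d\in\mathbb{N}$. Consider the function $$f(k)=\frac{d!}{d^{k-1}(d-k+1)!}\left(\frac{k}{12}+\frac12\right)$$ of $k\in\mathbb{N}$ (for $k\le d+1$, so that $(d-k+1)!$ is defined). Then $f$ attains its maximum at $k=-3+\lceil\sqrt{16+d}\rceil$. -}

module Defs where

open import Data.Nat using (ℕ; zero; suc; _∸_; _^_; _*_; _≤_; s≤s; z≤n; NonZero; >-nonZero; _!)
open import Data.Nat.Properties using (m^n≢0; m*n≢0; _!≢0)
open import Data.Integer using (+_)
open import Data.Rational using (ℚ; _/_) renaming (_+_ to _+ℚ_; _*_ to _*ℚ_)
open import Data.Product using (_×_)

IsCeilSqrt : ℕ → ℕ → Set
IsCeilSqrt n c = (n ≤ c * c) × (∀ m → n ≤ m * m → c ≤ m)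

-- d^(k-1) is nonzero on the domain 1 ≤ k ≤ d+1 (with 0^0 = 1).
powNZ : ∀ d k → 1 ≤ k → k ≤ suc d → NonZero (d ^ (k ∸ 1))
powNZ d (suc zero) _ _ = >-nonZero (s≤s z≤n)
powNZ (suc d) (suc (suc j)) _ _ = m^n≢0 (suc d) (suc j)
powNZ zero (suc (suc j)) _ (s≤s ())

denNZ : ∀ d k → 1 ≤ k → k ≤ suc d → NonZero (d ^ (k ∸ 1) * (suc d ∸ k) !)
denNZ d k p q = m*n≢0 (d ^ (k ∸ 1)) ((suc d ∸ k) !) {{powNZ d k p q}} {{(suc d ∸ k) !≢0}}

f : (d k : ℕ) → 1 ≤ k → k ≤ suc d → ℚ
f d k p q = ((+ (d !)) / (d ^ (k ∸ 1) * (suc d ∸ k) !)) {{denNZ d k p q}}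
            *ℚ ((+ k / 12) +ℚ (+ 1 / 2))

-- Consecutive values satisfy f(k+1)/f(k) = (k+7)(d+1−k) / ((k+6)d), and
-- (k+7)(d+1−k) − (k+6)d = (16+d) − (k+3)². So f rises while (k+3)² ≤ 16+d and falls once
-- (k+3)² ≥ 16+d; a sequence that rises up to an index and falls after it is maximal there,
-- and the turning index is k = ⌈√(16+d)⌉ − 3.
module Submission where

open import Defs
open import Data.Nat using (ℕ; _+_; _∸_; _≤_; suc)
open import Data.Rational using () renaming (_≤_ to _≤ℚ_)
open import Data.Product using (Σ)
open import Data.Nat using (zero; _*_; _^_; _!; _<_; _⊓_; z≤n; s≤s; s≤s⁻¹; NonZero)
open import Data.Nat.Properties
open import Data.Nat.Tactic.RingSolver using (solve-∀)
open import Data.Integer as ℤ using (+_)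
open import Data.Integer.Properties using (pos-*)
open import Data.Rational as ℚ using (toℚᵘ)
import Data.Rational.Properties as ℚ
open import Data.Rational.Unnormalised as ℚᵘ using (*≡*; *≤*) renaming (_≃_ to _≃ᵘ_; _≤_ to _≤ᵘ_)
import Data.Rational.Unnormalised.Properties as ℚᵘ
open import Data.Product using (∃-syntax; _×_; _,_)
open import Data.Sum using (inj₁; inj₂)
open import Relation.Binary.Bundles using (Preorder; TotalPreorder)
open import Relation.Binary.PropositionalEquality
open import Relation.Nullary.Decidable using (from-no)

module _ {a ℓ₁ ℓ₂} (P : Preorder a ℓ₁ ℓ₂) (g : ℕ → Preorder.Carrier P) where
  open Preorder P using (_≲_) renaming (refl to ≲-refl; trans to ≲-trans)

  increasing⇒≲ : ∀ {m} → (∀ i → i < m → g i ≲ g (suc i)) → ∀ {k} → k ≤ m → g k ≲ g m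
  increasing⇒≲ {zero}  up z≤n = ≲-refl
  increasing⇒≲ {suc m} up k≤1+m with m≤n⇒m<n∨m≡n k≤1+m
  ... | inj₂ refl = ≲-refl
  ... | inj₁ k<1+m =
    ≲-trans (increasing⇒≲ (λ i i<m → up i (m<n⇒m<1+n i<m)) (s≤s⁻¹ k<1+m)) (up m ≤-refl)

  decreasing⇒≲ : ∀ {m n} → (∀ i → m ≤ i → i < n → g (suc i) ≲ g i) → ∀ {k} → m ≤ k → k ≤ n → g k ≲ g m
  decreasing⇒≲ down {zero}  z≤n _ = ≲-refl
  decreasing⇒≲ down {suc k} m≤1+k 1+k≤n with m≤n⇒m<n∨m≡n m≤1+k
  ... | inj₂ refl = ≲-refl
  ... | inj₁ m<1+k =
    ≲-trans (down k (s≤s⁻¹ m<1+k) 1+k≤n) (decreasing⇒≲ down (s≤s⁻¹ m<1+k) (<⇒≤ 1+k≤n))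

  unimodal⇒≲ : ∀ {m n} → (∀ i → i < m → g i ≲ g (suc i)) → (∀ i → m ≤ i → i < n → g (suc i) ≲ g i) →
               ∀ {k} → k ≤ n → g k ≲ g m
  unimodal⇒≲ {m} up down {k} k≤n with ≤-total k m
  ... | inj₁ k≤m = increasing⇒≲ up k≤m
  ... | inj₂ m≤k = decreasing⇒≲ down m≤k k≤n

m+n≡o+p⇒p≤n⇒m≤o : ∀ {m n o p} → m + n ≡ o + p → p ≤ n → m ≤ o
m+n≡o+p⇒p≤n⇒m≤o {m} {n} {o} {p} eq p≤n = +-cancelʳ-≤ p m o (begin
  m + p  ≤⟨ +-monoʳ-≤ m p≤n ⟩
  m + n  ≡⟨ eq ⟩
  o + p  ∎)
  where open ≤-Reasoning

above-ceilSqrt : ∀ {n c i} → IsCeilSqrt n c → c ≤ i → n ≤ i * i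
above-ceilSqrt (n≤c*c , _) c≤i = ≤-trans n≤c*c (*-mono-≤ c≤i c≤i)

below-ceilSqrt : ∀ {n c i} → IsCeilSqrt n c → i < c → i * i < n
below-ceilSqrt (_ , least) i<c = ≰⇒> (λ n≤i*i → <⇒≱ i<c (least _ n≤i*i))

16+d≤[4+d]² : ∀ d → 16 + d ≤ (4 + d) * (4 + d)
16+d≤[4+d]² d = subst (16 + d ≤_) (sym (expand d)) (m≤m+n (16 + d) (7 * d + d * d))
  where
  expand : ∀ d → (4 + d) * (4 + d) ≡ 16 + d + (7 * d + d * d)
  expand = solve-∀

ceilSqrt[16+d]≡4+m : ∀ {d c} → IsCeilSqrt (16 + d) c → ∃[ m ] c ≡ 4 + m × m ≤ d
ceilSqrt[16+d]≡4+m {d} {c} ceil@(_ , least) =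
  c ∸ 4 , sym (m+[n∸m]≡n 4≤c) , ∸-monoˡ-≤ 4 (least (4 + d) (16+d≤[4+d]² d))
  where
  4≤c : 4 ≤ c
  4≤c = ≰⇒> (λ c≤3 → from-no (16 ≤? 9) (m+n≤o⇒m≤o 16 (above-ceilSqrt ceil c≤3)))

toℚᵘ-/ : ∀ a b .{{_ : NonZero b}} → toℚᵘ (+ a ℚ./ b) ≃ᵘ + a ℚᵘ./ b
toℚᵘ-/ a (suc b) = ℚ.toℚᵘ-fromℚᵘ (ℚᵘ.mkℚᵘ (+ a) b)

/*/≃ : ∀ a b c e .{{_ : NonZero b}} .{{_ : NonZero e}} →
      (+ a ℚᵘ./ b) ℚᵘ.* (+ c ℚᵘ./ e) ≃ᵘ (+ (a * c) ℚᵘ./ (b * e)) {{m*n≢0 b e}}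
/*/≃ a (suc b) c (suc e) = *≡* (cong (ℤ._* + (suc b * suc e)) (sym (pos-* a c)))

k/12+1/2≃[6+k]/12 : ∀ k → (+ k ℚᵘ./ 12) ℚᵘ.+ (+ 1 ℚᵘ./ 2) ≃ᵘ + (6 + k) ℚᵘ./ 12
k/12+1/2≃[6+k]/12 k = *≡* (begin
  (+ k ℤ.* + 2 ℤ.+ + 12) ℤ.* + 12  ≡⟨ cong (λ i → (i ℤ.+ + 12) ℤ.* + 12) (sym (pos-* k 2)) ⟩
  + (k * 2 + 12) ℤ.* + 12          ≡⟨ sym (pos-* (k * 2 + 12) 12) ⟩
  + ((k * 2 + 12) * 12)            ≡⟨ cong +_ (scale k) ⟩
  + ((6 + k) * 24)                 ≡⟨ pos-* (6 + k) 24 ⟩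
  + (6 + k) ℤ.* + 24               ∎)
  where
  open ≡-Reasoning
  scale : ∀ k → (k * 2 + 12) * 12 ≡ (6 + k) * 24
  scale = solve-∀

/≤/ : ∀ a b c e .{{_ : NonZero b}} .{{_ : NonZero e}} → a * e ≤ c * b → + a ℚᵘ./ b ≤ᵘ + c ℚᵘ./ e
/≤/ a (suc b) c (suc e) le = *≤* (subst₂ ℤ._≤_ (pos-* a (suc e)) (pos-* c (suc b)) (ℤ.+≤+ le))

den : ℕ → ℕ → ℕ
den d k = d ^ (k ∸ 1) * (suc d ∸ k) !

f-≃ : ∀ {d k} (p : 1 ≤ k) (q : k ≤ suc d) .{{_ : NonZero (den d k)}} →
      toℚᵘ (f d k p q) ≃ᵘ (+ (d ! * (6 + k)) ℚᵘ./ (den d k * 12)) {{m*n≢0 (den d k) 12}}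
f-≃ {d} {k} p q = ℚᵘ.≃-trans (ℚ.toℚᵘ-homo-* (+ (d !) ℚ./ den d k) (+ k ℚ./ 12 ℚ.+ + 1 ℚ./ 2))
  (ℚᵘ.≃-trans (ℚᵘ.*-cong (toℚᵘ-/ (d !) (den d k)) factor) (/*/≃ (d !) (den d k) (6 + k) 12))
  where
  factor : toℚᵘ (+ k ℚ./ 12 ℚ.+ + 1 ℚ./ 2) ≃ᵘ + (6 + k) ℚᵘ./ 12
  factor = ℚᵘ.≃-trans (ℚ.toℚᵘ-homo-+ (+ k ℚ./ 12) (+ 1 ℚ./ 2))
             (ℚᵘ.≃-trans (ℚᵘ.+-cong (toℚᵘ-/ k 12) (toℚᵘ-/ 1 2)) (k/12+1/2≃[6+k]/12 k))

f-≤ : ∀ {d k m} (p : 1 ≤ k) (q : k ≤ suc d) (p′ : 1 ≤ m) (q′ : m ≤ suc d) →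
      (6 + k) * den d m ≤ (6 + m) * den d k → f d k p q ≤ℚ f d m p′ q′
f-≤ {d} {k} {m} p q p′ q′ h = ℚ.toℚᵘ-cancel-≤
  (ℚᵘ.≤-respˡ-≃ (ℚᵘ.≃-sym (f-≃ p q)) (ℚᵘ.≤-respʳ-≃ (ℚᵘ.≃-sym (f-≃ p′ q′))
    (/≤/ _ _ _ _ {{m*n≢0 (den d k) 12}} {{m*n≢0 (den d m) 12}}
      (subst₂ _≤_ (scale (d !) (6 + k) (den d m)) (scale (d !) (6 + m) (den d k)) (*-monoʳ-≤ (d ! * 12) h)))))
  where
  instance
    den[k]≢0 : NonZero (den d k)
    den[k]≢0 = denNZ d k p q
    den[m]≢0 : NonZero (den d m)
    den[m]≢0 = denNZ d m p′ q′
  scale : ∀ x a b → x * 12 * (a * b) ≡ x * a * (b * 12)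
  scale = solve-∀

den-step : ∀ {d j} → j < d → ∀ a → d * (a * den d (1 + j)) ≡ a * (d ∸ j) * den d (2 + j)
den-step {d} {j} j<d a = begin
  d * (a * (d ^ j * (d ∸ j) !))      ≡⟨ cong (λ n → d * (a * (d ^ j * n !))) d∸j≡1+e ⟩
  d * (a * (d ^ j * (suc e * e !)))  ≡⟨ regroup d a (d ^ j) e (e !) ⟩
  a * suc e * (d * d ^ j * e !)      ≡⟨ cong (λ n → a * n * (d * d ^ j * e !)) d∸j≡1+e ⟨
  a * (d ∸ j) * den d (2 + j)        ∎
  where
  open ≡-Reasoning
  e : ℕ
  e = d ∸ suc j
  d∸j≡1+e : d ∸ j ≡ suc e
  d∸j≡1+e = +-∸-assoc 1 j<d
  regroup : ∀ d a p e F → d * (a * (p * (suc e * F))) ≡ a * suc e * (d * p * F)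
  regroup = solve-∀

ratio-vs-square : ∀ {j d} → j ≤ d → d * (7 + j) + (16 + d) ≡ (8 + j) * (d ∸ j) + (4 + j) * (4 + j)
ratio-vs-square {j} {d} j≤d = begin
  d * (7 + j) + (16 + d)               ≡⟨ cong (λ n → n * (7 + j) + (16 + n)) (m+[n∸m]≡n j≤d) ⟨
  (j + e) * (7 + j) + (16 + (j + e))   ≡⟨ expand j e ⟩
  (8 + j) * e + (4 + j) * (4 + j)      ∎
  where
  open ≡-Reasoning
  e : ℕ
  e = d ∸ j
  expand : ∀ j e → (j + e) * (7 + j) + (16 + (j + e)) ≡ (8 + j) * e + (4 + j) * (4 + j)
  expand = solve-∀

-- f as a total sequence indexed by k ∸ 1, frozen at its last value k = d + 1 beyond the domain.
f-clamped : ℕ → ℕ → ℚ.ℚ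
f-clamped d j = f d (suc (j ⊓ d)) (s≤s z≤n) (s≤s (m⊓n≤n j d))

f-cong : ∀ {d k m} p q p′ q′ → k ≡ m → f d k p q ≡ f d m p′ q′
f-cong _ _ _ _ refl = refl

f≡f-clamped : ∀ {d j} (p : 1 ≤ suc j) (q : suc j ≤ suc d) → f d (suc j) p q ≡ f-clamped d j
f≡f-clamped {d} {j} p q@(s≤s j≤d) =
  f-cong p q (s≤s z≤n) (s≤s (m⊓n≤n j d)) (cong suc (sym (m≤n⇒m⊓n≡m j≤d)))

f-clamped-≤ : ∀ {d i j} → i ≤ d → j ≤ d →
              (7 + i) * den d (1 + j) ≤ (7 + j) * den d (1 + i) → f-clamped d i ≤ℚ f-clamped d j
f-clamped-≤ i≤d j≤d h = subst₂ _≤ℚ_ (f≡f-clamped (s≤s z≤n) (s≤s i≤d)) (f≡f-clamped (s≤s z≤n) (s≤s j≤d))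
  (f-≤ (s≤s z≤n) (s≤s i≤d) (s≤s z≤n) (s≤s j≤d) h)

f-clamped-rises : ∀ {d j} → j < d → d * (7 + j) ≤ (8 + j) * (d ∸ j) → f-clamped d j ≤ℚ f-clamped d (suc j)
f-clamped-rises {d} {j} j<d@(s≤s _) h = f-clamped-≤ (<⇒≤ j<d) j<d (*-cancelˡ-≤ d (begin
  d * ((7 + j) * den d (2 + j))      ≡⟨ *-assoc d (7 + j) (den d (2 + j)) ⟨
  d * (7 + j) * den d (2 + j)        ≤⟨ *-monoˡ-≤ (den d (2 + j)) h ⟩
  (8 + j) * (d ∸ j) * den d (2 + j)  ≡⟨ den-step j<d (8 + j) ⟨
  d * ((8 + j) * den d (1 + j))      ∎))
  where open ≤-Reasoning

f-clamped-falls : ∀ {d j} → j < d → (8 + j) * (d ∸ j) ≤ d * (7 + j) → f-clamped d (suc j) ≤ℚ f-clamped d j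
f-clamped-falls {d} {j} j<d@(s≤s _) h = f-clamped-≤ j<d (<⇒≤ j<d) (*-cancelˡ-≤ d (begin
  d * ((8 + j) * den d (1 + j))      ≡⟨ den-step j<d (8 + j) ⟩
  (8 + j) * (d ∸ j) * den d (2 + j)  ≤⟨ *-monoˡ-≤ (den d (2 + j)) h ⟩
  d * (7 + j) * den d (2 + j)        ≡⟨ *-assoc d (7 + j) (den d (2 + j)) ⟩
  d * ((7 + j) * den d (2 + j))      ∎))
  where open ≤-Reasoning

lemma2p6 : (d c : ℕ) → IsCeilSqrt (16 + d) c →
    Σ (1 ≤ c ∸ 3) λ p → Σ (c ∸ 3 ≤ suc d) λ q →
      ∀ k (p′ : 1 ≤ k) (q′ : k ≤ suc d) → f d k p′ q′ ≤ℚ f d (c ∸ 3) p q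
lemma2p6 d c ceil with ceilSqrt[16+d]≡4+m ceil
... | m , refl , m≤d = s≤s z≤n , s≤s m≤d , maximum
  where
  rises : ∀ i → i < m → f-clamped d i ≤ℚ f-clamped d (suc i)
  rises i i<m = f-clamped-rises i<d (m+n≡o+p⇒p≤n⇒m≤o (ratio-vs-square (<⇒≤ i<d)) [4+i]²≤16+d)
    where
    i<d : i < d
    i<d = <-≤-trans i<m m≤d
    [4+i]²≤16+d : (4 + i) * (4 + i) ≤ 16 + d
    [4+i]²≤16+d = <⇒≤ (below-ceilSqrt ceil (+-monoʳ-< 4 i<m))
  falls : ∀ i → m ≤ i → i < d → f-clamped d (suc i) ≤ℚ f-clamped d i
  falls i m≤i i<d = f-clamped-falls i<d
    (m+n≡o+p⇒p≤n⇒m≤o (sym (ratio-vs-square (<⇒≤ i<d))) (above-ceilSqrt ceil (+-monoʳ-≤ 4 m≤i)))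
  maximum : ∀ k (p′ : 1 ≤ k) (q′ : k ≤ suc d) → f d k p′ q′ ≤ℚ f d (suc m) (s≤s z≤n) (s≤s m≤d)
  maximum (suc j) p′ q′ = subst₂ _≤ℚ_ (sym (f≡f-clamped p′ q′)) (sym (f≡f-clamped (s≤s z≤n) (s≤s m≤d)))
    (unimodal⇒≲ (TotalPreorder.preorder ℚ.≤-totalPreorder) (f-clamped d) rises falls (s≤s⁻¹ q′))
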